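{- Let $\mathcal{S}=\langle\mathcal{L},\vdash\rangle$ be a monotonic and transitive logic, where $\mathcal{L}$ is the formula algebra over a nonempty set of variables $V$ in a finite signature containing a binary conjunction operator $\land$, and suppose that for all $\alpha,\beta\in\mathcal{L}$, $\{\alpha\land\beta\}\vdash\alpha$ and $\{\alpha\land\beta\}\vdash\beta$. If $\mathcal{S}$ is finitely trivializable, then spECQ, pfECQ, and gECQ hold in $\mathcal{S}$.
   Context: A logic is a pair $\langle\mathcal{L},\vdash\rangle$ with $\vdash\,\subseteq\mathcal{P}(\mathcal{L})\times\mathcal{L}$; $C_\vdash(\Gamma)=\{\alpha:\Gamma\vdash\alpha\}$. Monotonic: $\Gamma\subseteq\Sigma$ implies $C_\vdash(\Gamma)\subseteq C_\vdash(\Sigma)$. Transitive: $\Sigma\subseteq C_\vdash(\Gamma)$ implies $C_\vdash(\Sigma)\subseteq C_\vdash(\Gamma)$. Finitely trivializable: there is a finite $\Gamma\subseteq\mathcal{L}$ with $C_\vdash(\Gamma)=\mathcal{L}$. spECQ: for every $\Gamma\subsetneq\mathcal{L}$ there is $\alpha\in\mathcal{L}$ with $\Gamma\cup\{\alpha\}\subsetneq\mathcal{L}$ and $C_\vdash(\Gamma\cup\{\alpha\})=\mathcal{L}$. pfECQ: for every $\Gamma\subsetneq\mathcal{L}$ there is $\Delta\subsetneq\mathcal{L}$ with $\Gamma\subseteq\Delta$ and $C_\vdash(\Delta)=\mathcal{L}$. gECQ: for each $\alpha\in\mathcal{L}$ there is $\beta\in\mathcal{L}$ with $C_\vdash(\{\alpha,\beta\})=\mathcal{L}$.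 -}

module Defs where

open import Data.Nat using (ℕ)
open import Data.Fin using (Fin; zero; suc)
open import Data.List using (List)
open import Data.List.Membership.Propositional using (_∈_)
open import Data.Product using (Σ; _×_; _,_; ∃)
open import Data.Sum using (_⊎_)
open import Data.Empty using (⊥)
open import Relation.Nullary using (¬_)
open import Relation.Unary using (Pred)
open import Relation.Binary.PropositionalEquality using (_≡_; subst)
open import Function.Bundles using (_↔_)
open import Level using (0ℓ)

record Signature : Set₁ where
  field
    Op       : Set
    arity    : Op → ℕ
    finite   : Σ ℕ λ n → Op ↔ Fin n
    ∧op      : Op
    ∧-binary : arity ∧op ≡ 2

module _ (Sig : Signature) where
  open Signature Sig

  data Formula (V : Set) : Set where
    var : V → Formula V
    op  : (o : Op) → (Fin (arity o) → Formula V) → Formula V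

  pair : {A : Set} → A → A → Fin 2 → A
  pair a b zero    = a
  pair a b (suc _) = b

  conj : {V : Set} → Formula V → Formula V → Formula V
  conj α β = op ∧op (λ i → pair α β (subst Fin ∧-binary i))

Sub : Set → Set₁
Sub L = Pred L 0ℓ

module _ {L : Set} (_⊢_ : Sub L → L → Set) where

  _⊆ˢ_ : Sub L → Sub L → Set
  Γ ⊆ˢ Δ = ∀ x → Γ x → Δ x

  Trivial : Sub L → Set
  Trivial Γ = ∀ β → Γ ⊢ β

  -- Γ ⊊ L  (read constructively: some formula lies outside Γ)
  Proper : Sub L → Set
  Proper Γ = ∃ λ δ → ¬ Γ δ

  Monotonic : Set₁
  Monotonic = ∀ (Γ Δ : Sub L) (α : L) → Γ ⊆ˢ Δ → Γ ⊢ α → Δ ⊢ α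

  Transitive : Set₁
  Transitive = ∀ (Γ Δ : Sub L) → (∀ σ → Δ σ → Γ ⊢ σ) → ∀ α → Δ ⊢ α → Γ ⊢ α

  FiniteSub : Sub L → Set
  FiniteSub Γ = Σ (List L) λ xs → ∀ x → (Γ x → x ∈ xs) × (x ∈ xs → Γ x)

  FinitelyTrivializable : Set₁
  FinitelyTrivializable = Σ (Sub L) λ Γ → FiniteSub Γ × Trivial Γ

  _∪｛_｝ : Sub L → L → Sub L
  (Γ ∪｛ α ｝) x = Γ x ⊎ x ≡ α

  spECQ : Set₁
  spECQ = ∀ (Γ : Sub L) → Proper Γ →
          Σ L λ α → Proper (Γ ∪｛ α ｝) × Trivial (Γ ∪｛ α ｝)

  pfECQ : Set₁
  pfECQ = ∀ (Γ : Sub L) → Proper Γ →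
          Σ (Sub L) λ Δ → Proper Δ × Γ ⊆ˢ Δ × Trivial Δ

  gECQ : Set
  gECQ = ∀ (α : L) → Σ L λ β → Trivial (λ x → x ≡ α ⊎ x ≡ β)

-- A finite trivializing set collapses, via conjunction elimination and
-- transitivity, to a single formula φ with {φ} ⊢ everything; monotonicity then
-- gives gECQ with partner φ. For spECQ, given Γ missing δ, add a formula that
-- still entails φ but cannot equal δ: the iterated self-conjunction
-- φ ∧ φ, (φ ∧ φ) ∧ (φ ∧ φ), …, taken deeper than δ along leftmost arguments.
{-# OPTIONS --safe #-}
module Submission where

open import Defs
open import Data.Nat using (ℕ; zero; suc; _≤_; z≤n; s≤s)
open import Data.Nat.Properties using (<⇒≢)
open import Data.Fin using (Fin; zero)
open import Data.List using (List; []; _∷_)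
open import Data.List.Membership.Propositional using (_∈_)
open import Data.List.Relation.Unary.Any using (here; there)
open import Data.Product using (_×_; _,_; Σ; proj₁; proj₂)
open import Data.Sum using (inj₁; inj₂; [_,_])
open import Function using (_∘_)
open import Relation.Binary.PropositionalEquality using (_≡_; _≢_; refl; sym; cong; subst)

selfConj : {L : Set} → (L → L → L) → ℕ → L → L
selfConj _∧_ zero    φ = φ
selfConj _∧_ (suc k) φ = selfConj _∧_ k φ ∧ selfConj _∧_ k φ

module Logic {L : Set} (_⊢_ : Sub L → L → Set) where

  ｛_｝ : L → Sub L
  ｛ a ｝ x = x ≡ a

  spECQ⇒pfECQ : spECQ _⊢_ → pfECQ _⊢_
  spECQ⇒pfECQ sp Γ proper with sp Γ proper
  ... | _ , proper′ , trivial = _ , proper′ , (λ _ → inj₁) , trivial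

  module _ (mono : Monotonic _⊢_) where

    Trivial-mono : ∀ {Γ Δ : Sub L} → (∀ x → Γ x → Δ x) → Trivial _⊢_ Γ → Trivial _⊢_ Δ
    Trivial-mono Γ⊆Δ trivial β = mono _ _ β Γ⊆Δ (trivial β)

    trivial-formula⇒gECQ : ∀ {φ} → Trivial _⊢_ ｛ φ ｝ → gECQ _⊢_
    trivial-formula⇒gECQ {φ} trivial _ = φ , Trivial-mono (λ _ → inj₂) trivial

    escape⇒spECQ : (f : L → L) → (∀ δ → f δ ≢ δ) → (∀ δ → Trivial _⊢_ ｛ f δ ｝) →
                   spECQ _⊢_
    escape⇒spECQ f f≢ trivial Γ (δ , δ∉Γ) =
      f δ , (δ , [ δ∉Γ , f≢ δ ∘ sym ]) , Trivial-mono (λ _ → inj₂) (trivial δ)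

  module _ (trans : Transitive _⊢_) where

    Trivial-cut : ∀ {Γ Δ} → (∀ σ → Δ σ → Γ ⊢ σ) → Trivial _⊢_ Δ → Trivial _⊢_ Γ
    Trivial-cut Γ⊢Δ trivial β = trans _ _ Γ⊢Δ β (trivial β)

    Trivial-singleton-cut : ∀ {a b} → ｛ a ｝ ⊢ b → Trivial _⊢_ ｛ b ｝ → Trivial _⊢_ ｛ a ｝
    Trivial-singleton-cut a⊢b = Trivial-cut λ { _ refl → a⊢b }

    module Conjunction (_∧_ : L → L → L)
                       (∧-elimˡ : ∀ α β → ｛ α ∧ β ｝ ⊢ α)
                       (∧-elimʳ : ∀ α β → ｛ α ∧ β ｝ ⊢ β) where

      ⋀ : L → List L → L
      ⋀ ⊤₀ []       = ⊤₀
      ⋀ ⊤₀ (x ∷ xs) = x ∧ ⋀ ⊤₀ xs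

      ⋀-⊢-∈ : ∀ ⊤₀ {x} xs → x ∈ xs → ｛ ⋀ ⊤₀ xs ｝ ⊢ x
      ⋀-⊢-∈ ⊤₀ (x ∷ xs) (here refl) = ∧-elimˡ x (⋀ ⊤₀ xs)
      ⋀-⊢-∈ ⊤₀ (y ∷ xs) (there x∈xs) =
        trans _ ｛ ⋀ ⊤₀ xs ｝ (λ { _ refl → ∧-elimʳ y (⋀ ⊤₀ xs) }) _ (⋀-⊢-∈ ⊤₀ xs x∈xs)

      -- The argument is the empty conjunction, needed only when the trivializing set is empty.
      trivial-formula : L → FinitelyTrivializable _⊢_ → Σ L λ φ → Trivial _⊢_ ｛ φ ｝
      trivial-formula ⊤₀ (Γ , (xs , Γ≈xs) , trivial) =
        ⋀ ⊤₀ xs , Trivial-cut (λ σ σ∈Γ → ⋀-⊢-∈ ⊤₀ xs (proj₁ (Γ≈xs σ) σ∈Γ)) trivial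

      Trivial-selfConj : ∀ {φ} k → Trivial _⊢_ ｛ φ ｝ → Trivial _⊢_ ｛ selfConj _∧_ k φ ｝
      Trivial-selfConj zero    trivial = trivial
      Trivial-selfConj {φ} (suc k) trivial =
        Trivial-singleton-cut (∧-elimˡ (selfConj _∧_ k φ) (selfConj _∧_ k φ))
                              (Trivial-selfConj k trivial)

module Syntax (Sig : Signature) {V : Set} where
  open Signature Sig

  mutual
    leftDepth : Formula Sig V → ℕ
    leftDepth (var _)     = 0
    leftDepth (op o args) = suc (firstArgDepth (arity o) args)

    firstArgDepth : (n : ℕ) → (Fin n → Formula Sig V) → ℕ
    firstArgDepth zero    args = 0
    firstArgDepth (suc n) args = leftDepth (args zero)

  leftDepth-conj : ∀ α β → leftDepth (conj Sig α β) ≡ suc (leftDepth α)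
  leftDepth-conj α β = cong suc (firstArg (arity ∧op) ∧-binary)
    where
    firstArg : ∀ n (n≡2 : n ≡ 2) →
               firstArgDepth n (λ i → pair Sig α β (subst Fin n≡2 i)) ≡ leftDepth α
    firstArg .2 refl = refl

  leftDepth-selfConj : ∀ k φ → k ≤ leftDepth (selfConj (conj Sig) k φ)
  leftDepth-selfConj zero    φ = z≤n
  leftDepth-selfConj (suc k) φ
    rewrite leftDepth-conj (selfConj (conj Sig) k φ) (selfConj (conj Sig) k φ) =
    s≤s (leftDepth-selfConj k φ)

  selfConj-escapes : ∀ φ δ → selfConj (conj Sig) (suc (leftDepth δ)) φ ≢ δ
  selfConj-escapes φ δ eq =
    <⇒≢ (leftDepth-selfConj (suc (leftDepth δ)) φ) (cong leftDepth (sym eq))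

theorem3p31 : (Sig : Signature) (V : Set) → V →
    (_⊢_ : Sub (Formula Sig V) → Formula Sig V → Set) →
    Monotonic _⊢_ → Transitive _⊢_ →
    (∀ α β → (λ x → x ≡ conj Sig α β) ⊢ α) →
    (∀ α β → (λ x → x ≡ conj Sig α β) ⊢ β) →
    FinitelyTrivializable _⊢_ →
    spECQ _⊢_ × pfECQ _⊢_ × gECQ _⊢_
theorem3p31 Sig V v _⊢_ mono trans ∧-elimˡ ∧-elimʳ finitelyTrivial =
  sp , spECQ⇒pfECQ sp , trivial-formula⇒gECQ mono φ-trivial
  where
  open Logic _⊢_
  open Conjunction trans (conj Sig) ∧-elimˡ ∧-elimʳ
  open Syntax Sig

  φ : Formula Sig V
  φ = proj₁ (trivial-formula (var v) finitelyTrivial)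

  φ-trivial : Trivial _⊢_ ｛ φ ｝
  φ-trivial = proj₂ (trivial-formula (var v) finitelyTrivial)

  sp : spECQ _⊢_
  sp = escape⇒spECQ mono (λ δ → selfConj (conj Sig) (suc (leftDepth δ)) φ)
         (selfConj-escapes φ) (λ δ → Trivial-selfConj (suc (leftDepth δ)) φ-trivial)
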